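{- Let $n\geq 2$ and $i\geq 1$ be integers. Then $\mathrm{dc}([\overrightarrow{C}_n]^i)=T_n(i)$.
   Context: $\overrightarrow{C}_n$ is the directed cycle with vertex set $\mathbb{Z}_n$ and arcs $j\to j+1$. The lexicographic product $D[H]$ has vertex set $V(D)\times V(H)$, with an arc from $(u,a)$ to $(v,b)$ iff $uv\in A(D)$, or $u=v$ and $ab\in A(H)$. Define $[H]^1=H$ and $[H]^{i+1}=([H]^i)[H]$ for $i\geq 1$. The dichromatic number $\mathrm{dc}(D)$ is the smallest $k$ such that $V(D)$ can be partitioned into $k$ classes each inducing a subdigraph with no directed cycle. $T_n$ is defined by $T_n(0)=1$ and $T_n(i)=\lceil \tfrac{n}{n-1}T_n(i-1)\rceil$ for $i\geq 1$. -}

module Defs where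

open import Data.Nat using (ℕ; zero; suc; _+_; _*_; _/_; _≤_; _<_)
open import Data.Fin using (Fin; toℕ)
open import Data.Product using (Σ; _×_; _,_)
open import Data.Sum using (_⊎_)
open import Relation.Binary.PropositionalEquality using (_≡_)
open import Relation.Nullary using (¬_)
open import Function.Definitions using (Injective)

record Digraph : Set₁ where
  field
    V   : Set
    Arc : V → V → Set
open Digraph public

-- Arc relation of the directed cycle on ℤ_n = Fin n : j → j+1 (mod n).
CycArc : (n : ℕ) → Fin n → Fin n → Set
CycArc n a b = (suc (toℕ a) ≡ toℕ b) ⊎ ((suc (toℕ a) ≡ n) × (toℕ b ≡ 0))

C⃗ : ℕ → Digraph
C⃗ n = record { V = Fin n ; Arc = CycArc n }

lex : Digraph → Digraph → Digraph
lex D H = record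
  { V   = V D × V H
  ; Arc = λ { (u , a) (v , b) → Arc D u v ⊎ ((u ≡ v) × Arc H a b) } }

-- Iterated lexicographic power: pow H 1 = H, pow H (i+1) = (pow H i)[H].
-- (pow H 0 is a junk value, equal to H; it is never used since i ≥ 1.)
pow : Digraph → ℕ → Digraph
pow H zero = H
pow H (suc zero) = H
pow H (suc (suc i)) = lex (pow H (suc i)) H

DirectedCycleIn : (D : Digraph) → (V D → Set) → Set
DirectedCycleIn D P =
  Σ ℕ λ k → Σ (Fin k → V D) λ f →
    (1 ≤ k) × Injective _≡_ _≡_ f × (∀ j → P (f j))
    × (∀ a b → CycArc k a b → Arc D (f a) (f b))

AcyclicColouring : (D : Digraph) → (k : ℕ) → (V D → Fin k) → Set
AcyclicColouring D k c = ∀ (col : Fin k) → ¬ DirectedCycleIn D (λ v → c v ≡ col)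

Colourable : Digraph → ℕ → Set
Colourable D k = Σ (V D → Fin k) λ c → AcyclicColouring D k c

DichromaticNumberIs : Digraph → ℕ → Set
DichromaticNumberIs D k = Colourable D k × (∀ m → m < k → ¬ Colourable D m)

-- T_n(0) = 1, T_n(i) = ⌈ n T_n(i-1) / (n-1) ⌉.  Only meaningful for n ≥ 2
-- (n = s+2); the ceiling is computed as (n t + (n-2)) / (n-1).
-- For n < 2 it is a junk value (never used).
T : ℕ → ℕ → ℕ
T (suc (suc s)) (suc i) = (suc (suc s) * T (suc (suc s)) i + s) / suc s
T _ _ = 1

module Submission where

-- Writing n = s + 2, everything follows by induction on i from dc(C⃗ₙ[D]) = ⌈ n·dc(D) / (n-1) ⌉,
-- because [C⃗ₙ]^(i+1) and C⃗ₙ[[C⃗ₙ]^i] embed into each other (associativity of the lexicographic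
-- product).  For the upper bound let k = dc(D), m = ⌈nk/(n-1)⌉ and r = m - k ≥ 1, and colour row p
-- of C⃗ₙ[D] by an acyclic k-colouring of D shifted so that the colours in [p·r, p·r + r) are skipped;
-- m ≤ n·r, so every colour is missing from some row.  A directed cycle that avoids a row of C⃗ₙ
-- cannot wind around C⃗ₙ, so it stays inside a single row, where the shift is injective.
-- For the lower bound each row needs at least k colours, while no colour occurs in every row
-- (one vertex per row would form a monochromatic directed cycle); double counting gives
-- n·k ≤ m·(n-1).

open import Defs
open import Data.Nat using (ℕ; zero; suc; _+_; _*_; _∸_; _/_; _%_; _≤_; _<_; z≤n; s≤s; s≤s⁻¹; NonZero; >-nonZero)
open import Data.Nat.Properties
open import Data.Nat.DivMod using (m<n*o⇒m/o<n; m≡m%n+[m/n]*n; m%n<n; m/n*n≤m)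
open import Data.Vec.Functional using (removeAt)
open import Data.Fin using (Fin; zero; suc; toℕ; fromℕ; fromℕ<; inject₁; punchIn) renaming (_≟_ to _≟ᶠ_)
open import Data.Fin.Properties using (toℕ-injective; toℕ-fromℕ; toℕ-fromℕ<; toℕ-inject₁; toℕ<n; ¬Fin0; any?; all?; ¬∀⟶∃¬)
  renaming (suc-injective to suc-injectiveᶠ)
open import Data.Fin.Induction using (<-weakInduction; >-weakInduction)
open import Data.Product using (∃; _×_; _,_; proj₁; proj₂)
open import Data.Product.Properties using (,-injectiveˡ; ,-injectiveʳ)
open import Data.Sum using (_⊎_; inj₁; inj₂)
open import Data.Unit using (⊤; tt)
open import Data.Empty using (⊥)
open import Function using (_∘_)
open import Function.Definitions using (Injective)
open import Level using (0ℓ)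
open import Relation.Binary.Core using (Rel)
open import Relation.Binary.Definitions using (Reflexive; Transitive)
open import Relation.Binary.PropositionalEquality
open import Relation.Nullary using (¬_; Dec; yes; no; contradiction)
open import Relation.Nullary.Decidable using (map′)
open import Relation.Unary using (Pred; Decidable)

open import Algebra.Properties.CommutativeMonoid.Sum +-0-commutativeMonoid
  using (sum; sum-syntax; sum-remove; ∑-comm)

cycArc-inject₁ : ∀ {k} (i : Fin k) → CycArc (suc k) (inject₁ i) (suc i)
cycArc-inject₁ i = inj₁ (cong suc (toℕ-inject₁ i))

cycArc-fromℕ : ∀ k → CycArc (suc k) (fromℕ k) zero
cycArc-fromℕ k = inj₂ (cong suc (toℕ-fromℕ k) , refl)

module _ {k ℓ} {A : Set} (_∼_ : Rel A ℓ) (∼-refl : Reflexive _∼_) (∼-trans : Transitive _∼_)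
         (g : Fin (suc k) → A) (∼-arc : ∀ i j → CycArc (suc k) i j → g i ∼ g j) where

  ∼-from-zero : ∀ i → g zero ∼ g i
  ∼-from-zero = <-weakInduction (λ i → g zero ∼ g i) ∼-refl
    (λ i 0∼i → ∼-trans 0∼i (∼-arc _ _ (cycArc-inject₁ i)))

  ∼-to-last : ∀ i → g i ∼ g (fromℕ k)
  ∼-to-last = >-weakInduction (λ i → g i ∼ g (fromℕ k)) ∼-refl
    (λ i i+1∼k → ∼-trans (∼-arc _ _ (cycArc-inject₁ i)) i+1∼k)

monotone-around-cycle⇒constant : ∀ {k} (g : Fin (suc k) → ℕ) →
  (∀ i j → CycArc (suc k) i j → g i ≤ g j) → ∀ i → g i ≡ g zero
monotone-around-cycle⇒constant {k} g mono i = ≤-antisym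
  (≤-trans (∼-to-last _≤_ ≤-refl ≤-trans g mono i) (mono _ _ (cycArc-fromℕ k)))
  (∼-from-zero _≤_ ≤-refl ≤-trans g mono i)

record _↪_ (A B : Digraph) : Set where
  field
    vertex    : V A → V B
    injective : Injective _≡_ _≡_ vertex
    arc       : ∀ {x y} → Arc A x y → Arc B (vertex x) (vertex y)
open _↪_

↪-refl : ∀ {A} → A ↪ A
↪-refl = record { vertex = λ x → x ; injective = λ eq → eq ; arc = λ a → a }

↪-trans : ∀ {A B C} → A ↪ B → B ↪ C → A ↪ C
↪-trans e f = record
  { vertex = vertex f ∘ vertex e ; injective = injective e ∘ injective f ; arc = arc f ∘ arc e }

_↩↪_ : Digraph → Digraph → Set
A ↩↪ B = A ↪ B × B ↪ A

DirectedCycleIn-↪ : ∀ {A B} {P : V B → Set} (e : A ↪ B) →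
  DirectedCycleIn A (P ∘ vertex e) → DirectedCycleIn B P
DirectedCycleIn-↪ e (k , f , k≥1 , f-inj , fP , f-arc) =
  k , vertex e ∘ f , k≥1 , f-inj ∘ injective e , fP , λ i j ij → arc e (f-arc i j ij)

AcyclicColouring-↪ : ∀ {A B m c} (e : A ↪ B) → AcyclicColouring B m c → AcyclicColouring A m (c ∘ vertex e)
AcyclicColouring-↪ {c = c} e acyclic col = acyclic col ∘ DirectedCycleIn-↪ {P = λ v → c v ≡ col} e

Colourable-↪ : ∀ {A B m} → A ↪ B → Colourable B m → Colourable A m
Colourable-↪ e (c , acyclic) = c ∘ vertex e , AcyclicColouring-↪ {c = c} e acyclic

DichromaticNumberIs-↩↪ : ∀ {A B k} → A ↩↪ B → DichromaticNumberIs B k → DichromaticNumberIs A k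
DichromaticNumberIs-↩↪ (A↪B , B↪A) (colourable , minimal) =
  Colourable-↪ A↪B colourable , λ m m<k → minimal m m<k ∘ Colourable-↪ B↪A

AcyclicColouring-refine : ∀ {D m m′ c} (c′ : V D → Fin m′) → (∀ u v → c′ u ≡ c′ v → c u ≡ c v) →
  AcyclicColouring D m c → AcyclicColouring D m′ c′
AcyclicColouring-refine c′ refines acyclic col (zero , _ , () , _)
AcyclicColouring-refine {c = c} c′ refines acyclic col (suc k , f , k≥1 , f-inj , same , f-arc) =
  acyclic (c (f zero)) (suc k , f , k≥1 , f-inj , (λ i → refines _ _ (trans (same i) (sym (same zero)))) , f-arc)

K₁ : Digraph
K₁ = record { V = ⊤ ; Arc = λ _ _ → ⊥ }

dc-K₁ : DichromaticNumberIs K₁ 1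
dc-K₁ = ((λ _ → zero) , λ { _ (suc k , _ , _ , _ , _ , f-arc) → f-arc _ _ (cycArc-fromℕ k) })
      , λ { zero _ (c , _) → ¬Fin0 (c tt) ; (suc m) (s≤s ()) }

lex-assoc : ∀ {A B C} → lex (lex A B) C ↪ lex A (lex B C)
lex-assoc = record
  { vertex    = λ { ((a , b) , c) → a , (b , c) }
  ; injective = λ { refl → refl }
  ; arc       = λ { (inj₁ (inj₁ ab)) → inj₁ ab
                  ; (inj₁ (inj₂ (refl , bb))) → inj₂ (refl , inj₁ bb)
                  ; (inj₂ (refl , cc)) → inj₂ (refl , inj₂ (refl , cc)) } }

lex-assoc⁻¹ : ∀ {A B C} → lex A (lex B C) ↪ lex (lex A B) C
lex-assoc⁻¹ = record
  { vertex    = λ { (a , (b , c)) → (a , b) , c }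
  ; injective = λ { refl → refl }
  ; arc       = λ { (inj₁ aa) → inj₁ (inj₁ aa)
                  ; (inj₂ (refl , inj₁ bb)) → inj₁ (inj₂ (refl , bb))
                  ; (inj₂ (refl , inj₂ (refl , cc))) → inj₂ (refl , cc) } }

lex-congˡ : ∀ {A B C} → A ↪ B → lex A C ↪ lex B C
lex-congˡ e = record
  { vertex    = λ { (a , c) → vertex e a , c }
  ; injective = λ eq → cong₂ _,_ (injective e (,-injectiveˡ eq)) (,-injectiveʳ eq)
  ; arc       = λ { (inj₁ aa) → inj₁ (arc e aa) ; (inj₂ (refl , cc)) → inj₂ (refl , cc) } }

lex-identityʳ : ∀ {A} → A ↪ lex A K₁
lex-identityʳ = record { vertex = _, tt ; injective = ,-injectiveˡ ; arc = inj₁ }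

lex-identityʳ⁻¹ : ∀ {A} → lex A K₁ ↪ A
lex-identityʳ⁻¹ = record
  { vertex = proj₁ ; injective = λ eq → cong (_, tt) eq ; arc = λ { (inj₁ aa) → aa ; (inj₂ (_ , ())) } }

lex-row : ∀ {A B} (a : V A) → B ↪ lex A B
lex-row a = record { vertex = a ,_ ; injective = ,-injectiveʳ ; arc = λ bb → inj₂ (refl , bb) }

Searchable : Set → Set₁
Searchable A = ∀ {P : Pred A 0ℓ} → Decidable P → Dec (∃ P)

⊤-searchable : Searchable ⊤
⊤-searchable P? = map′ (tt ,_) proj₂ (P? tt)

×-searchable : ∀ {A B} → Searchable A → Searchable B → Searchable (A × B)
×-searchable search-A search-B P? =
  map′ (λ (a , b , p) → (a , b) , p) (λ ((a , b) , p) → a , b , p)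
       (search-A λ a → search-B λ b → P? (a , b))

indicator : ∀ {P : Set} → Dec P → ℕ
indicator (yes _) = 1
indicator (no _)  = 0

indicator≤1 : ∀ {P : Set} (P? : Dec P) → indicator P? ≤ 1
indicator≤1 (yes _) = ≤-refl
indicator≤1 (no _)  = z≤n

sum-mono-≤ : ∀ {m} {f g : Fin m → ℕ} → (∀ i → f i ≤ g i) → sum f ≤ sum g
sum-mono-≤ {zero}  f≤g = z≤n
sum-mono-≤ {suc m} f≤g = +-mono-≤ (f≤g zero) (sum-mono-≤ (f≤g ∘ suc))

sum-const : ∀ m c → ∑[ i < m ] c ≡ m * c
sum-const zero    c = refl
sum-const (suc m) c = cong (c +_) (sum-const m c)

count : ∀ {m} {P : Pred (Fin m) 0ℓ} → Decidable P → ℕ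
count {m} P? = ∑[ x < m ] indicator (P? x)

count-≤-missing : ∀ {m} {P : Pred (Fin (suc m)) 0ℓ} (P? : Decidable P) {j} → ¬ P j → count P? ≤ m
count-≤-missing {m} {P} P? {j} ¬Pj = begin
  count P?                               ≡⟨ sum-remove {i = j} χ ⟩
  indicator (P? j) + sum (removeAt χ j)  ≡⟨ cong (_+ sum (removeAt χ j)) (indicator-no (P? j)) ⟩
  sum (removeAt χ j)                     ≤⟨ sum-mono-≤ {g = λ _ → 1} (λ i → indicator≤1 (P? (punchIn j i))) ⟩
  ∑[ i < m ] 1                           ≡⟨ trans (sum-const m 1) (*-identityʳ m) ⟩
  m                                      ∎
  where
  open ≤-Reasoning
  indicator-no : (d : Dec (P j)) → indicator d ≡ 0
  indicator-no (yes Pj) = contradiction Pj ¬Pj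
  indicator-no (no _)   = refl
  χ : Fin (suc m) → ℕ
  χ = indicator ∘ P?

rank : ∀ {m} {P : Pred (Fin m) 0ℓ} (P? : Decidable P) x → P x → Fin (count P?)
rank P? zero    Px with P? zero
... | yes _  = zero
... | no ¬Px = contradiction Px ¬Px
rank P? (suc x) Px with P? zero
... | yes _ = suc (rank (P? ∘ suc) x Px)
... | no _  = rank (P? ∘ suc) x Px

rank-injective : ∀ {m} {P : Pred (Fin m) 0ℓ} (P? : Decidable P) {x y} (Px : P x) (Py : P y) →
  rank P? x Px ≡ rank P? y Py → x ≡ y
rank-injective P? {zero}  {zero}  Px Py eq = refl
rank-injective P? {zero}  {suc y} Px Py eq with P? zero
... | yes _  = contradiction eq λ ()
... | no ¬Px = contradiction Px ¬Px
rank-injective P? {suc x} {zero}  Px Py eq with P? zero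
... | yes _  = contradiction eq λ ()
... | no ¬Py = contradiction Py ¬Py
rank-injective P? {suc x} {suc y} Px Py eq with P? zero
... | yes _ = cong suc (rank-injective (P? ∘ suc) Px Py (suc-injectiveᶠ eq))
... | no _  = cong suc (rank-injective (P? ∘ suc) Px Py eq)

Colourable-count : ∀ {D m c} {P : Pred (Fin m) 0ℓ} (P? : Decidable P) →
  AcyclicColouring D m c → (∀ v → P (c v)) → Colourable D (count P?)
Colourable-count {D} {c = c} P? acyclic P∘c =
  c′ , AcyclicColouring-refine {D} c′ (λ u v → rank-injective P? (P∘c u) (P∘c v)) acyclic
  where
  c′ : V D → Fin (count P?)
  c′ v = rank P? (c v) (P∘c v)

-- Position of row p on the path j+1, …, n-1, 0, …, j obtained by cutting C⃗ₙ after row j.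
unroll : (n j p : ℕ) → ℕ
unroll n j p with j <? p
... | yes _ = p
... | no _  = p + n

unroll-step : ∀ {n j p q} → j < n → p ≢ j → suc p ≡ q ⊎ (suc p ≡ n × q ≡ 0) →
  unroll n j q ≡ suc (unroll n j p)
unroll-step {n} {j} {p} {q} j<n p≢j arc with j <? p | j <? q | arc
... | yes _   | yes _   | inj₁ p+1≡q          = sym p+1≡q
... | _       | yes ()  | inj₂ (_ , refl)
... | yes j<p | no j≮q  | inj₁ refl           = contradiction (m<n⇒m<1+n j<p) j≮q
... | yes _   | no _    | inj₂ (p+1≡n , refl) = sym p+1≡n
... | no j≮p  | yes j<q | inj₁ refl           = contradiction (≤-antisym (≮⇒≥ j≮p) (s≤s⁻¹ j<q)) p≢j
... | no _    | no _    | inj₁ refl           = refl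
... | no j≮p  | no _    | inj₂ (refl , refl)  = contradiction (≤∧≢⇒< (s≤s⁻¹ j<n) (p≢j ∘ sym)) j≮p

cycle-avoiding-row⇒within-row : ∀ {n D} {P : Pred (Fin n × V D) 0ℓ} (j₀ : Fin n) → (∀ v → ¬ P (j₀ , v)) →
  DirectedCycleIn (lex (C⃗ n) D) P → ∃ λ p → DirectedCycleIn D (λ v → P (p , v))
cycle-avoiding-row⇒within-row j₀ avoids (zero , _ , () , _)
cycle-avoiding-row⇒within-row {n} {D} {P} j₀ avoids (suc k , f , k≥1 , f-inj , fP , f-arc) =
  row zero , suc k , column , k≥1 , column-injective , column-P , λ i j ij → proj₂ (within-row i j ij)
  where
  row : Fin (suc k) → Fin n
  row = proj₁ ∘ f
  column : Fin (suc k) → V D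
  column = proj₂ ∘ f

  row≢j₀ : ∀ i → toℕ (row i) ≢ toℕ j₀
  row≢j₀ i eq = avoids (column i) (subst (λ r → P (r , column i)) (toℕ-injective eq) (fP i))

  weight : Fin (suc k) → ℕ
  weight = unroll n (toℕ j₀) ∘ toℕ ∘ row

  weight-step : ∀ {i j} → CycArc n (row i) (row j) → weight j ≡ suc (weight i)
  weight-step {i} = unroll-step (toℕ<n j₀) (row≢j₀ i)

  weight-monotone : ∀ i j → CycArc (suc k) i j → weight i ≤ weight j
  weight-monotone i j ij with f-arc i j ij
  ... | inj₁ between    = ≤-trans (n≤1+n _) (≤-reflexive (sym (weight-step between)))
  ... | inj₂ (same , _) = ≤-reflexive (cong (unroll n (toℕ j₀) ∘ toℕ) same)

  weight-constant : ∀ i → weight i ≡ weight zero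
  weight-constant = monotone-around-cycle⇒constant weight weight-monotone

  within-row : ∀ i j → CycArc (suc k) i j → row i ≡ row j × Arc D (column i) (column j)
  within-row i j ij with f-arc i j ij
  ... | inj₂ same-row = same-row
  ... | inj₁ between = contradiction
    (trans (weight-constant j) (sym (weight-constant i))) (1+n≢n ∘ trans (sym (weight-step between)))

  row-constant : ∀ i → row zero ≡ row i
  row-constant = ∼-from-zero _≡_ refl trans row λ i j ij → proj₁ (within-row i j ij)

  column-injective : Injective _≡_ _≡_ column
  column-injective {i} {j} eq = f-inj (cong₂ _,_ (trans (sym (row-constant i)) (row-constant j)) eq)

  column-P : ∀ i → P (row zero , column i)
  column-P i = subst (λ r → P (r , column i)) (sym (row-constant i)) (fP i)

transversal-cycle : ∀ {n D} {P : Pred (Fin (suc n) × V D) 0ℓ} (v : Fin (suc n) → V D) →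
  (∀ j → P (j , v j)) → DirectedCycleIn (lex (C⃗ (suc n)) D) P
transversal-cycle v Pv = _ , (λ j → j , v j) , s≤s z≤n , ,-injectiveˡ , Pv , λ _ _ → inj₁

-- Row p keeps the colours below p·r and moves the others up by r, leaving [p·r, p·r + r) unused.
shift : (r p x : ℕ) → ℕ
shift r p x with x <? p * r
... | yes _ = x
... | no _  = x + r

shift-< : ∀ r p {x k} → x < k → shift r p x < k + r
shift-< r p {x} {k} x<k with x <? p * r
... | yes _ = ≤-trans x<k (m≤m+n k r)
... | no _  = +-monoˡ-< r x<k

shift-injective : ∀ r p {x y} → shift r p x ≡ shift r p y → x ≡ y
shift-injective r p {x} {y} eq with x <? p * r | y <? p * r
... | yes _   | yes _   = eq
... | no _    | no _    = +-cancelʳ-≡ r x y eq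
... | yes x<  | no y≮   = contradiction (<-≤-trans (s≤s (≤-trans (m≤m+n y r) (≤-reflexive (sym eq)))) x<) y≮
... | no x≮   | yes y<  = contradiction (<-≤-trans (s≤s (≤-trans (m≤m+n x r) (≤-reflexive eq))) y<) x≮

shift-skips : ∀ r .{{_ : NonZero r}} x y → shift r (y / r) x ≢ y
shift-skips r x y eq with x <? (y / r) * r
... | yes x< = <⇒≱ x< (≤-trans (m/n*n≤m y r) (≤-reflexive (sym eq)))
... | no x≮  = x≮ (+-cancelʳ-< r x _ (begin-strict
  x + r                   ≡⟨ eq ⟩
  y                       ≡⟨ m≡m%n+[m/n]*n y r ⟩
  y % r + (y / r) * r     <⟨ +-monoˡ-< _ (m%n<n y r) ⟩
  r + (y / r) * r         ≡⟨ +-comm r _ ⟩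
  (y / r) * r + r         ∎))
  where open ≤-Reasoning

lex-cycle-colourable : ∀ {n k m D} → Colourable D k → k < m → m ≤ n * (m ∸ k) →
  Colourable (lex (C⃗ n) D) m
lex-cycle-colourable {n} {k} {m} {D} (c , acyclic) k<m m≤n[m∸k] = c* , acyclic*
  where
  r : ℕ
  r = m ∸ k
  instance
    r≢0 : NonZero r
    r≢0 = >-nonZero (m<n⇒0<n∸m k<m)

  colour<m : ∀ p v → shift r (toℕ p) (toℕ (c v)) < m
  colour<m p v = <-≤-trans (shift-< r (toℕ p) (toℕ<n (c v))) (≤-reflexive (m+[n∸m]≡n (<⇒≤ k<m)))

  c* : Fin n × V D → Fin m
  c* (p , v) = fromℕ< (colour<m p v)

  toℕ-c* : ∀ p v → toℕ (c* (p , v)) ≡ shift r (toℕ p) (toℕ (c v))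
  toℕ-c* p v = toℕ-fromℕ< (colour<m p v)

  row-acyclic : ∀ p → AcyclicColouring D m (λ v → c* (p , v))
  row-acyclic p = AcyclicColouring-refine {D} _ (λ u v eq → toℕ-injective (shift-injective r (toℕ p)
    (trans (sym (toℕ-c* p u)) (trans (cong toℕ eq) (toℕ-c* p v))))) acyclic

  j₀<n : ∀ (col : Fin m) → toℕ col / r < n
  j₀<n col = m<n*o⇒m/o<n (<-≤-trans (toℕ<n col) m≤n[m∸k])

  skipping-row : Fin m → Fin n
  skipping-row col = fromℕ< (j₀<n col)

  skips : ∀ col v → c* (skipping-row col , v) ≢ col
  skips col v eq = shift-skips r (toℕ (c v)) (toℕ col)
    (subst (λ p → shift r p (toℕ (c v)) ≡ toℕ col) (toℕ-fromℕ< (j₀<n col))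
      (trans (sym (toℕ-c* (skipping-row col) v)) (cong toℕ eq)))

  acyclic* : AcyclicColouring (lex (C⃗ n) D) m c*
  acyclic* col cycle
    with cycle-avoiding-row⇒within-row {D = D} {P = λ x → c* x ≡ col} (skipping-row col) (skips col) cycle
  ... | p , row-cycle = row-acyclic p col row-cycle

lex-cycle-colourable⇒[1+n]k≤mn : ∀ {n k m D} → Searchable (V D) → (∀ m′ → m′ < k → ¬ Colourable D m′) →
  Colourable (lex (C⃗ (suc n)) D) m → suc n * k ≤ m * n
lex-cycle-colourable⇒[1+n]k≤mn {n} {k} {m} {D} search needs-k (c , acyclic) = begin
  suc n * k                                           ≡⟨ sum-const (suc n) k ⟨
  ∑[ j < suc n ] k                                    ≤⟨ sum-mono-≤ row-uses-k ⟩
  ∑[ j < suc n ] ∑[ x < m ] indicator (uses? j x)     ≡⟨ ∑-comm (λ j x → indicator (uses? j x)) ⟩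
  ∑[ x < m ] ∑[ j < suc n ] indicator (uses? j x)     ≤⟨ sum-mono-≤ colour-misses-row ⟩
  ∑[ x < m ] n                                        ≡⟨ sum-const m n ⟩
  m * n                                               ∎
  where
  open ≤-Reasoning
  uses : Fin (suc n) → Pred (Fin m) 0ℓ
  uses j x = ∃ λ v → c (j , v) ≡ x
  uses? : ∀ j → Decidable (uses j)
  uses? j x = search λ v → c (j , v) ≟ᶠ x

  row-uses-k : ∀ j → k ≤ count (uses? j)
  row-uses-k j = ≮⇒≥ λ fewer → needs-k _ fewer
    (Colourable-count {D} (uses? j) (AcyclicColouring-↪ {c = c} (lex-row {C⃗ (suc n)} {D} j) acyclic)
      (λ v → v , refl))

  colour-misses-row : ∀ x → count (λ j → uses? j x) ≤ n
  colour-misses-row x with all? (λ j → uses? j x)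
  ... | yes used-everywhere =
    contradiction (transversal-cycle {D = D} {P = λ y → c y ≡ x}
      (proj₁ ∘ used-everywhere) (proj₂ ∘ used-everywhere)) (acyclic x)
  ... | no ¬used-everywhere =
    count-≤-missing (λ j → uses? j x) (proj₂ (¬∀⟶∃¬ _ _ (λ j → uses? j x) ¬used-everywhere))

-- ⌈ (2+s) k / (1+s) ⌉, so that T (2+s) (suc i) = nextT s (T (2+s) i) holds by definition.
nextT : ℕ → ℕ → ℕ
nextT s k = (suc (suc s) * k + s) / suc s

nextT-least : ∀ s {k m} → suc (suc s) * k ≤ m * suc s → nextT s k ≤ m
nextT-least s {k} {m} le = s≤s⁻¹ (m<n*o⇒m/o<n (begin-strict
  suc (suc s) * k + s   ≤⟨ +-monoˡ-≤ s le ⟩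
  m * suc s + s         <⟨ +-monoʳ-< (m * suc s) (n<1+n s) ⟩
  m * suc s + suc s     ≡⟨ +-comm (m * suc s) (suc s) ⟩
  suc m * suc s         ∎))
  where open ≤-Reasoning

[2+s]k≤nextT*[1+s] : ∀ s k → suc (suc s) * k ≤ nextT s k * suc s
[2+s]k≤nextT*[1+s] s k = +-cancelˡ-≤ s _ _ (begin
  s + suc (suc s) * k            ≡⟨ +-comm s _ ⟩
  X                              ≡⟨ m≡m%n+[m/n]*n X (suc s) ⟩
  X % suc s + nextT s k * suc s  ≤⟨ +-monoˡ-≤ _ (s≤s⁻¹ (m%n<n X (suc s))) ⟩
  s + nextT s k * suc s          ∎)
  where
  X = suc (suc s) * k + s
  open ≤-Reasoning

k<nextT : ∀ s {k} → 1 ≤ k → k < nextT s k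
k<nextT s {k} k≥1 = ≰⇒> λ T≤k → <⇒≱ (begin-strict
  nextT s k * suc s  ≤⟨ *-monoˡ-≤ (suc s) T≤k ⟩
  k * suc s          ≡⟨ *-comm k (suc s) ⟩
  suc s * k          <⟨ +-monoˡ-< (suc s * k) k≥1 ⟩
  suc (suc s) * k    ∎) ([2+s]k≤nextT*[1+s] s k)
  where open ≤-Reasoning

nextT≤[2+s]*[nextT∸k] : ∀ s k → nextT s k ≤ suc (suc s) * (nextT s k ∸ k)
nextT≤[2+s]*[nextT∸k] s k = begin
  t                                         ≡⟨ m+n∸n≡m t (suc (suc s) * k) ⟨
  t + suc (suc s) * k ∸ suc (suc s) * k     ≤⟨ ∸-monoˡ-≤ (suc (suc s) * k)
                                                 (+-monoʳ-≤ t (≤-trans ([2+s]k≤nextT*[1+s] s k) (≤-reflexive (*-comm t (suc s))))) ⟩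
  t + suc s * t ∸ suc (suc s) * k           ≡⟨ *-distribˡ-∸ (suc (suc s)) t k ⟨
  suc (suc s) * (t ∸ k)                     ∎
  where
  t = nextT s k
  open ≤-Reasoning

dc-lex-cycle : ∀ {s k D} → Searchable (V D) → 1 ≤ k → DichromaticNumberIs D k →
  DichromaticNumberIs (lex (C⃗ (suc (suc s))) D) (nextT s k)
dc-lex-cycle {s} {k} {D} search k≥1 (colourable , needs-k) =
  lex-cycle-colourable {D = D} colourable (k<nextT s k≥1) (nextT≤[2+s]*[nextT∸k] s k) ,
  λ m m<T colourable′ → <⇒≱ m<T
    (nextT-least s {k} {m} (lex-cycle-colourable⇒[1+n]k≤mn {D = D} search needs-k colourable′))

pow-suc : ∀ H i → pow H (suc (suc i)) ↩↪ lex H (pow H (suc i))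
pow-suc H zero    = ↪-refl , ↪-refl
pow-suc H (suc i) = ↪-trans (lex-congˡ (proj₁ (pow-suc H i))) lex-assoc
                  , ↪-trans lex-assoc⁻¹ (lex-congˡ (proj₂ (pow-suc H i)))

pow-searchable : ∀ {H} → Searchable (V H) → ∀ i → Searchable (V (pow H i))
pow-searchable search zero          = search
pow-searchable search (suc zero)    = search
pow-searchable search (suc (suc i)) = ×-searchable (pow-searchable search (suc i)) search

T-positive : ∀ s i → 1 ≤ T (suc (suc s)) i
T-positive s zero    = ≤-refl
T-positive s (suc i) = ≤-trans (T-positive s i) (<⇒≤ (k<nextT s (T-positive s i)))

dc-pow-cycle : ∀ s i → DichromaticNumberIs (pow (C⃗ (suc (suc s))) (suc i)) (T (suc (suc s)) (suc i))
dc-pow-cycle s zero    = DichromaticNumberIs-↩↪ (lex-identityʳ {C⃗ (suc (suc s))} , lex-identityʳ⁻¹)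
  (dc-lex-cycle {s} {D = K₁} ⊤-searchable ≤-refl dc-K₁)
dc-pow-cycle s (suc i) = DichromaticNumberIs-↩↪ (pow-suc _ i)
  (dc-lex-cycle {s} {D = pow (C⃗ (suc (suc s))) (suc i)}
    (pow-searchable any? (suc i)) (T-positive s (suc i)) (dc-pow-cycle s i))

lemma17 : ∀ (n i : ℕ) → 2 ≤ n → 1 ≤ i → DichromaticNumberIs (pow (C⃗ n) i) (T n i)
lemma17 (suc (suc s)) (suc i) _ _ = dc-pow-cycle s i
lemma17 (suc zero)    _       (s≤s ()) _
lemma17 _             zero    _        ()
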